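{- Let $\mathcal{S}=\{S_1,\ldots,S_N\}$ be a family of integer sets over the universe $[0..u)$, each $S_i$ stored as its binary trie $\mathrm{bintrie}(S_i)$. Let $\mathcal{Q}=\{i_1,\ldots,i_k\}\subseteq[1..N]$ be a query instance with alternation measure $\delta$. Then the algorithm $\texttt{TP-Intersection}$ computes $\mathcal{I}(\mathcal{Q})=\bigcap_{i\in\mathcal{Q}}S_i$ in time $O(k\,\delta\lg(u/\delta))$.
   Context: Model: word RAM with word size $w=\Theta(\lg u)$. Let $\ell=\lceil\lg u\rceil$. For a set $S\subseteq[0..u)$, $\mathrm{bintrie}(S)$ is the binary trie obtained by inserting the $\ell$-bit binary encodings (most significant bit first) of all elements of $S$; only paths leading to elements exist, and all leaves are at depth $\ell$, one per element. The algorithm $\texttt{TP-Intersection}(S_1,\ldots,S_k;[L..R))$ (Trabb-Pardo): if some $S_i$ is empty return $\varnothing$; if $L=R$ return $\{L\}$; otherwise let $M=(L+R)/2$, split each $S_i$ into $S_{i,l}=S_i\cap[L..M)$ and $S_{i,r}=S_i\cap[M..R)$, recursively compute the intersections on $[L..M)$ and $[M..R)$ and return their union; $\mathcal{I}(\mathcal{Q})$ is computed by calling it with the query sets and universe $[0..u)$. On binary tries this is a synchronized depth-first traversal of $\mathrm{bintrie}(S_{i_1}),\ldots,\mathrm{bintrie}(S_{i_k})$ following the same path in all of them, backtracking as soon as a child is missing in one trie, and reporting an element when a leaf is reached in all tries. A partition certificate of $\mathcal{Q}$ is a partition $\mathcal{P}$ of $[0..u)$ into intervals such that (1) for every $x\in\mathcal{I}(\mathcal{Q})$,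 the singleton $[x..x]\in\mathcal{P}$; (2) for every $x\notin\mathcal{I}(\mathcal{Q})$ there is $I_j\in\mathcal{P}$ with $x\in I_j$ and some $q\in\mathcal{Q}$ with $S_q\cap I_j=\emptyset$. The alternation measure $\delta$ of $\mathcal{Q}$ is the size of the smallest partition certificate of $\mathcal{Q}$. -}

module Defs where

open import Data.Nat using (ℕ; zero; suc; _+_; _*_; _∸_; _^_; _≤_; _<_; _<ᵇ_; _/_)
open import Data.Nat.Logarithm using (⌊log₂_⌋; ⌈log₂_⌉)
open import Data.Bool using (if_then_else_)
open import Data.Maybe using (Maybe; just; nothing)
open import Data.List using (List; []; _∷_; _++_; foldl; length)
open import Data.List.Membership.Propositional using (_∈_)
open import Data.Vec using (Vec; []; _∷_; map)
open import Data.Fin using (Fin)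
open import Data.Product using (_×_; _,_; ∃-syntax; Σ-syntax)
open import Relation.Binary.PropositionalEquality using (_≡_)
open import Relation.Nullary using (¬_)

-- Binary tries of height h (leaves at depth h).  A (possibly empty) set
-- is represented as Maybe (Trie h): nothing = empty trie.

data Trie : ℕ → Set where
  leaf : Trie zero
  node : ∀ {h} → Maybe (Trie h) → Maybe (Trie h) → Trie (suc h)

leftChild : ∀ {h} → Trie (suc h) → Maybe (Trie h)
leftChild (node l r) = l

rightChild : ∀ {h} → Trie (suc h) → Maybe (Trie h)
rightChild (node l r) = r

insert : ∀ h → ℕ → Maybe (Trie h) → Trie h
insert zero x t = leaf
insert (suc h) x nothing =
  if x <ᵇ 2 ^ h
  then node (just (insert h x nothing)) nothing
  else node nothing (just (insert h (x ∸ 2 ^ h) nothing))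
insert (suc h) x (just (node l r)) =
  if x <ᵇ 2 ^ h
  then node (just (insert h x l)) r
  else node l (just (insert h (x ∸ 2 ^ h) r))

bintrie : ∀ h → List ℕ → Maybe (Trie h)
bintrie h = foldl (λ t x → just (insert h x t)) nothing

allJust : ∀ {A : Set} {k} → Vec (Maybe A) k → Maybe (Vec A k)
allJust [] = just []
allJust (nothing ∷ _) = nothing
allJust (just a ∷ v) with allJust v
... | nothing = nothing
... | just w = just (a ∷ w)

-- Returns (reported elements, cost).  Cost model: every attempted step
-- into a node (checking that node's presence in all k tries, O(1) each)
-- costs k; a visited node's subtree interval is [L .. L + 2^h).

mutual
  visit : ∀ {k} h → ℕ → Vec (Trie h) k → List ℕ × ℕ
  visit {k} zero L ts = (L ∷ [] , k)
  visit {k} (suc h) L ts with enter h L (allJust (map leftChild ts))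
                           | enter h (L + 2 ^ h) (allJust (map rightChild ts))
  ... | (rl , cl) | (rr , cr) = (rl ++ rr , k + cl + cr)

  enter : ∀ {k} h → ℕ → Maybe (Vec (Trie h) k) → List ℕ × ℕ
  enter {k} h L nothing = ([] , k)
  enter {k} h L (just ts) = visit h L ts

tpIntersection : ∀ {k} h → Vec (Maybe (Trie h)) k → List ℕ × ℕ
tpIntersection h roots = enter h 0 (allJust roots)

-- Partition certificates and the alternation measure.
-- Intervals are half-open [lo , hi) given as pairs (lo , hi), nonempty.
-- A partition of [a .. u) is a list of consecutive nonempty intervals.

IsPartitionFrom : ℕ → ℕ → List (ℕ × ℕ) → Set
IsPartitionFrom a u [] = a ≡ u
IsPartitionFrom a u ((lo , hi) ∷ P) = (lo ≡ a) × (lo < hi) × IsPartitionFrom hi u P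

InAll : ∀ {k} → (Fin k → List ℕ) → ℕ → Set
InAll T x = ∀ j → x ∈ T j

IsPartitionCertificate : ∀ {k} → ℕ → (Fin k → List ℕ) → List (ℕ × ℕ) → Set
IsPartitionCertificate u T P =
  IsPartitionFrom 0 u P
  × (∀ x → x < u → InAll T x → (x , suc x) ∈ P)
  × (∀ x → x < u → ¬ InAll T x →
       ∃[ lo ] ∃[ hi ] ((lo , hi) ∈ P × lo ≤ x × x < hi
         × ∃[ j ] (∀ y → lo ≤ y → y < hi → ¬ (y ∈ T j))))

IsAlternationMeasure : ∀ {k} → ℕ → (Fin k → List ℕ) → ℕ → Set
IsAlternationMeasure u T δ =
  (∃[ P ] (IsPartitionCertificate u T P × length P ≡ δ))
  × (∀ P → IsPartitionCertificate u T P → δ ≤ length P)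

-- ⌊lg (u/δ)⌋ (δ ≥ 1 always holds for the alternation measure when u ≥ 1)
lgRatio : ℕ → ℕ → ℕ
lgRatio u zero = 0
lgRatio u (suc d) = ⌊log₂ (u / suc d) ⌋

-- Read each binary trie as the set it stores on its dyadic window [L, L + 2^h); every internal
-- node of a trie built by insertion stores some element.  The synchronised traversal therefore
-- reports exactly the common elements, and every internal node it enters has all k sets meeting
-- its window.  By the partition certificate such a window, having length ≥ 2, strictly contains
-- the right endpoint of a certificate interval, and windows of one level are disjoint, so each
-- level holds at most δ entered internal nodes, each costing 2k for its two children.  Paying
-- for the top d = ⌊lg δ⌋ levels by their 2^(d+1) nodes and for each of the remaining
-- ⌈lg u⌉ − ⌊lg δ⌋ ≤ 2 + ⌊lg (u/δ)⌋ levels by 2kδ bounds the cost by 6kδ(1 + ⌊lg (u/δ)⌋).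

module Submission where

open import Defs
open import Data.Bool using (true; false)
open import Data.Empty using (⊥; ⊥-elim)
open import Data.Fin using (Fin; zero; suc)
open import Data.Fin.Properties using (all?)
open import Data.List using (List; []; _∷_; foldl; filter; length)
import Data.List as List
open import Data.List.Properties using (length-filter; filter-some; length-map)
open import Data.List.Membership.Propositional using (_∈_; lose)
open import Data.List.Membership.Propositional.Properties using (∈-map⁺; ∈-++⁺ˡ; ∈-++⁺ʳ; ∈-++⁻)
open import Data.List.Relation.Unary.Any using (Any; here; there)
open import Data.Maybe using (Maybe; just; nothing)
open import Data.Nat
open import Data.Nat.DivMod using (m≡m%n+[m/n]*n; m%n<n)
open import Data.Nat.Induction using (<-wellFounded)
open import Data.Nat.Logarithm using (⌊log₂_⌋; ⌈log₂_⌉; ⌊log₂⌋-mono-≤; ⌈log₂⌉-mono-≤; ⌊log₂[2^n]⌋≡n; ⌈log₂2^n⌉≡n)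
open import Data.Nat.Logarithm.Core using (⌊log2⌋; ⌈log2⌉)
open import Data.Nat.Properties
open import Data.List.Membership.DecPropositional _≟_ using (_∈?_)
open import Data.Nat.Tactic.RingSolver using (solve-∀)
open import Data.Product using (_×_; _,_; ∃-syntax; proj₁; proj₂)
open import Data.Sum using (_⊎_; inj₁; inj₂; map₂)
open import Data.Vec using (Vec; []; _∷_; map; lookup; tabulate)
open import Data.Vec.Properties using (lookup-map; lookup∘tabulate)
open import Function.Base using (_∘_)
open import Function.Bundles using (_⇔_; mk⇔; Equivalence)
open import Function.Definitions using (Injective)
open import Induction.WellFounded using (Acc; acc)
open import Relation.Binary.PropositionalEquality
open import Relation.Nullary using (¬_; Dec; yes; no; ofʸ; ofⁿ; _×-dec_)
open import Relation.Unary using (Decidable)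

open Equivalence using (to; from)

2^[1+n]≡2^n+2^n : ∀ n → 2 ^ suc n ≡ 2 ^ n + 2 ^ n
2^[1+n]≡2^n+2^n n = cong (2 ^ n +_) (+-identityʳ (2 ^ n))

m+2^n+2^n≡m+2^[1+n] : ∀ m n → m + 2 ^ n + 2 ^ n ≡ m + 2 ^ suc n
m+2^n+2^n≡m+2^[1+n] m n = trans (+-assoc m (2 ^ n) (2 ^ n)) (cong (m +_) (sym (2^[1+n]≡2^n+2^n n)))

m+2^n≤m+2^[1+n] : ∀ m n → m + 2 ^ n ≤ m + 2 ^ suc n
m+2^n≤m+2^[1+n] m n = +-monoʳ-≤ m (m≤m+n (2 ^ n) (2 ^ n + 0))

InRange : ℕ → ℕ → ℕ → Set
InRange L R y = L ≤ y × y < R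

lower-half-⊆ : ∀ L h {y} → InRange L (L + 2 ^ h) y → InRange L (L + 2 ^ suc h) y
lower-half-⊆ L h (L≤y , y<M) = L≤y , <-≤-trans y<M (m+2^n≤m+2^[1+n] L h)

upper-half-⊆ : ∀ L h {y} → InRange (L + 2 ^ h) (L + 2 ^ h + 2 ^ h) y → InRange L (L + 2 ^ suc h) y
upper-half-⊆ L h {y} (M≤y , y<R) = ≤-trans (m≤m+n L (2 ^ h)) M≤y , subst (y <_) (m+2^n+2^n≡m+2^[1+n] L h) y<R

inRange-halves : ∀ L h {y} → InRange L (L + 2 ^ suc h) y
               → InRange L (L + 2 ^ h) y ⊎ InRange (L + 2 ^ h) (L + 2 ^ h + 2 ^ h) y
inRange-halves L h {y} (L≤y , y<R) with y <? L + 2 ^ h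
... | yes y<M = inj₁ (L≤y , y<M)
... | no y≮M = inj₂ (≮⇒≥ y≮M , subst (y <_) (sym (m+2^n+2^n≡m+2^[1+n] L h)) y<R)

start-inRange : ∀ L h → InRange L (L + 2 ^ h) L
start-inRange L h = ≤-refl , m<m+n L (m^n>0 2 h)

Meets : ℕ → ℕ → (ℕ → Set) → Set
Meets L R P = ∃[ y ] (InRange L R y × P y)

meets-⊆ : ∀ {L R L′ R′ P} → (∀ {y} → InRange L′ R′ y → InRange L R y) → Meets L′ R′ P → Meets L R P
meets-⊆ ⊆ (y , y∈ , Py) = y , ⊆ y∈ , Py

AgreeOn : ℕ → ℕ → (ℕ → Set) → (ℕ → Set) → Set
AgreeOn L R P Q = ∀ {y} → InRange L R y → P y ⇔ Q y

meets-resp : ∀ {L R P Q} → AgreeOn L R P Q → Meets L R P → Meets L R Q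
meets-resp P≐Q (y , y∈ , Py) = y , y∈ , to (P≐Q y∈) Py

mutual
  Represents : ∀ h → ℕ → Maybe (Trie h) → (ℕ → Set) → Set
  Represents h L nothing P = ¬ Meets L (L + 2 ^ h) P
  Represents h L (just t) P = RepresentsT h L t P

  RepresentsT : ∀ h → ℕ → Trie h → (ℕ → Set) → Set
  RepresentsT zero L leaf P = P L
  RepresentsT (suc h) L (node l r) P =
    Represents h L l P × Represents h (L + 2 ^ h) r P × Meets L (L + 2 ^ suc h) P

representsT-meets : ∀ h L t {P} → RepresentsT h L t P → Meets L (L + 2 ^ h) P
representsT-meets zero L leaf PL = L , start-inRange L 0 , PL
representsT-meets (suc h) L (node l r) (_ , _ , meets) = meets

representsT-leaf : ∀ L t {P} → RepresentsT zero L t P → P L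
representsT-leaf L leaf PL = PL

leftChild-represents : ∀ h L t {P} → RepresentsT (suc h) L t P → Represents h L (leftChild t) P
leftChild-represents h L (node l r) (repl , _ , _) = repl

rightChild-represents : ∀ h L t {P} → RepresentsT (suc h) L t P → Represents h (L + 2 ^ h) (rightChild t) P
rightChild-represents h L (node l r) (_ , repr , _) = repr

mutual
  represents-resp : ∀ h L t {P Q} → AgreeOn L (L + 2 ^ h) P Q → Represents h L t P → Represents h L t Q
  represents-resp h L nothing P≐Q ¬meets (y , y∈ , Qy) = ¬meets (y , y∈ , from (P≐Q y∈) Qy)
  represents-resp h L (just t) = representsT-resp h L t

  representsT-resp : ∀ h L t {P Q} → AgreeOn L (L + 2 ^ h) P Q → RepresentsT h L t P → RepresentsT h L t Q
  representsT-resp zero L leaf P≐Q PL = to (P≐Q (start-inRange L 0)) PL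
  representsT-resp (suc h) L (node l r) P≐Q (repl , repr , meets) =
    represents-resp h L l (P≐Q ∘ lower-half-⊆ L h) repl ,
    represents-resp h (L + 2 ^ h) r (P≐Q ∘ upper-half-⊆ L h) repr ,
    meets-resp P≐Q meets

insert-node-represents : ∀ h L x l r {P} → x < 2 ^ suc h → Represents h L l P → Represents h (L + 2 ^ h) r P
                       → RepresentsT (suc h) L (insert (suc h) x (just (node l r))) (λ z → P z ⊎ z ≡ L + x)
insert-represents : ∀ h L x t {P} → x < 2 ^ h → Represents h L t P
                  → RepresentsT h L (insert h x t) (λ z → P z ⊎ z ≡ L + x)

insert-node-represents h L x l r x<2^[1+h] repl repr with x <ᵇ 2 ^ h | <ᵇ-reflects-< x (2 ^ h)
... | true | ofʸ x<2^h =
  insert-represents h L x l x<2^h repl ,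
  represents-resp h (L + 2 ^ h) r (λ (M≤z , _) → mk⇔ inj₁ λ where
      (inj₁ Pz) → Pz
      (inj₂ refl) → ⊥-elim (<⇒≱ (+-monoʳ-< L x<2^h) M≤z)) repr ,
  (L + x , (m≤m+n L x , +-monoʳ-< L x<2^[1+h]) , inj₂ refl)
... | false | ofⁿ x≮2^h =
  represents-resp h L l (λ (_ , z<M) → mk⇔ inj₁ λ where
      (inj₁ Pz) → Pz
      (inj₂ refl) → ⊥-elim (x≮2^h (+-cancelˡ-< L x (2 ^ h) z<M))) repl ,
  representsT-resp h (L + 2 ^ h) _
    (λ _ → mk⇔ (map₂ (λ e → trans e shift)) (map₂ (λ e → trans e (sym shift))))
    (insert-represents h (L + 2 ^ h) (x ∸ 2 ^ h) r x∸2^h<2^h repr) ,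
  (L + x , (m≤m+n L x , +-monoʳ-< L x<2^[1+h]) , inj₂ refl)
  where
  2^h≤x : 2 ^ h ≤ x
  2^h≤x = ≮⇒≥ x≮2^h
  shift : L + 2 ^ h + (x ∸ 2 ^ h) ≡ L + x
  shift = trans (+-assoc L (2 ^ h) (x ∸ 2 ^ h)) (cong (L +_) (m+[n∸m]≡n 2^h≤x))
  x∸2^h<2^h : x ∸ 2 ^ h < 2 ^ h
  x∸2^h<2^h = m<n+o⇒m∸n<o x (2 ^ h) {{m^n≢0 2 h}} (subst (x <_) (2^[1+n]≡2^n+2^n h) x<2^[1+h])

insert-represents zero L x t x<1 _ = inj₂ (sym (trans (cong (L +_) (n<1⇒n≡0 x<1)) (+-identityʳ L)))
insert-represents (suc h) L x nothing x<2^[1+h] ¬meets =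
  insert-node-represents h L x nothing nothing x<2^[1+h]
    (¬meets ∘ meets-⊆ (lower-half-⊆ L h)) (¬meets ∘ meets-⊆ (upper-half-⊆ L h))
insert-represents (suc h) L x (just (node l r)) x<2^[1+h] (repl , repr , _) =
  insert-node-represents h L x l r x<2^[1+h] repl repr

insertInto : ∀ h → Maybe (Trie h) → ℕ → Maybe (Trie h)
insertInto h t x = just (insert h x t)

foldl-insert-represents : ∀ h t xs {P} → (∀ x → x ∈ xs → x < 2 ^ h) → Represents h 0 t P
                        → Represents h 0 (foldl (insertInto h) t xs) (λ z → P z ⊎ z ∈ xs)
foldl-insert-represents h t [] _ rep =
  represents-resp h 0 t (λ _ → mk⇔ inj₁ λ { (inj₁ Pz) → Pz ; (inj₂ ()) }) rep
foldl-insert-represents h t (x ∷ xs) {P} bound rep =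
  represents-resp h 0 (foldl (insertInto h) (insertInto h t x) xs) (λ _ → mk⇔ reassoc reassoc⁻¹)
    (foldl-insert-represents h (insertInto h t x) xs (λ y → bound y ∘ there)
      (insert-represents h 0 x t (bound x (here refl)) rep))
  where
  reassoc : ∀ {z} → (P z ⊎ z ≡ x) ⊎ z ∈ xs → P z ⊎ z ∈ x ∷ xs
  reassoc (inj₁ (inj₁ Pz)) = inj₁ Pz
  reassoc (inj₁ (inj₂ z≡x)) = inj₂ (here z≡x)
  reassoc (inj₂ z∈xs) = inj₂ (there z∈xs)
  reassoc⁻¹ : ∀ {z} → P z ⊎ z ∈ x ∷ xs → (P z ⊎ z ≡ x) ⊎ z ∈ xs
  reassoc⁻¹ (inj₁ Pz) = inj₁ (inj₁ Pz)
  reassoc⁻¹ (inj₂ (here z≡x)) = inj₁ (inj₂ z≡x)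
  reassoc⁻¹ (inj₂ (there z∈xs)) = inj₂ z∈xs

bintrie-represents : ∀ h xs → (∀ x → x ∈ xs → x < 2 ^ h) → Represents h 0 (bintrie h xs) (_∈ xs)
bintrie-represents h xs bound =
  represents-resp h 0 (bintrie h xs) (λ _ → mk⇔ (λ { (inj₁ ()) ; (inj₂ z∈xs) → z∈xs }) inj₂)
    (foldl-insert-represents h nothing xs {λ _ → ⊥} bound λ { (_ , _ , ()) })

AllRepresent : ∀ {k} h → ℕ → Maybe (Vec (Trie h) k) → (Fin k → ℕ → Set) → Set
AllRepresent h L nothing T = ∃[ j ] ¬ Meets L (L + 2 ^ h) (T j)
AllRepresent h L (just ts) T = ∀ j → RepresentsT h L (lookup ts j) (T j)

allJust-represent : ∀ {k} h L (ts : Vec (Maybe (Trie h)) k) T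
                  → (∀ j → Represents h L (lookup ts j) (T j)) → AllRepresent h L (allJust ts) T
allJust-represent h L [] T reps ()
allJust-represent h L (nothing ∷ ts) T reps = zero , reps zero
allJust-represent h L (just t ∷ ts) T reps with allJust ts | allJust-represent h L ts (T ∘ suc) (reps ∘ suc)
... | nothing | (j , ¬meets) = suc j , ¬meets
... | just _  | reps′ = λ { zero → reps zero ; (suc j) → reps′ j }

leftChildren-represent : ∀ {k} h L (ts : Vec (Trie (suc h)) k) T → AllRepresent (suc h) L (just ts) T
                       → AllRepresent h L (allJust (map leftChild ts)) T
leftChildren-represent h L ts T reps = allJust-represent h L (map leftChild ts) T λ j →
  subst (λ t → Represents h L t (T j)) (sym (lookup-map j leftChild ts))
    (leftChild-represents h L (lookup ts j) (reps j))

rightChildren-represent : ∀ {k} h L (ts : Vec (Trie (suc h)) k) T → AllRepresent (suc h) L (just ts) T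
                        → AllRepresent h (L + 2 ^ h) (allJust (map rightChild ts)) T
rightChildren-represent h L ts T reps = allJust-represent h (L + 2 ^ h) (map rightChild ts) T λ j →
  subst (λ t → Represents h (L + 2 ^ h) t (T j)) (sym (lookup-map j rightChild ts))
    (rightChild-represents h L (lookup ts j) (reps j))

mutual
  enter-sound : ∀ {k} h L mv (T : Fin k → ℕ → Set) → AllRepresent h L mv T
              → ∀ {x} → x ∈ proj₁ (enter h L mv) → InRange L (L + 2 ^ h) x × (∀ j → T j x)
  enter-sound h L nothing T _ ()
  enter-sound h L (just ts) = visit-sound h L ts

  visit-sound : ∀ {k} h L (ts : Vec (Trie h) k) T → AllRepresent h L (just ts) T
              → ∀ {x} → x ∈ proj₁ (visit h L ts) → InRange L (L + 2 ^ h) x × (∀ j → T j x)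
  visit-sound zero L ts T reps (here refl) = start-inRange L 0 , λ j → representsT-leaf L (lookup ts j) (reps j)
  visit-sound (suc h) L ts T reps x∈ with ∈-++⁻ (proj₁ (enter h L (allJust (map leftChild ts)))) x∈
  ... | inj₁ x∈l with enter-sound h L _ T (leftChildren-represent h L ts T reps) x∈l
  ...   | x∈R , Tx = lower-half-⊆ L h x∈R , Tx
  visit-sound (suc h) L ts T reps x∈ | inj₂ x∈r
    with enter-sound h (L + 2 ^ h) _ T (rightChildren-represent h L ts T reps) x∈r
  ...   | x∈R , Tx = upper-half-⊆ L h x∈R , Tx

mutual
  enter-complete : ∀ {k} h L mv (T : Fin k → ℕ → Set) → AllRepresent h L mv T
                 → ∀ {x} → InRange L (L + 2 ^ h) x → (∀ j → T j x) → x ∈ proj₁ (enter h L mv)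
  enter-complete h L nothing T (j , ¬meets) x∈R Tx = ⊥-elim (¬meets (_ , x∈R , Tx j))
  enter-complete h L (just ts) = visit-complete h L ts

  visit-complete : ∀ {k} h L (ts : Vec (Trie h) k) T → AllRepresent h L (just ts) T
                 → ∀ {x} → InRange L (L + 2 ^ h) x → (∀ j → T j x) → x ∈ proj₁ (visit h L ts)
  visit-complete zero L ts T reps {x} (L≤x , x<L+1) Tx =
    here (≤-antisym (m<1+n⇒m≤n (subst (x <_) (+-comm L 1) x<L+1)) L≤x)
  visit-complete (suc h) L ts T reps x∈R Tx with inRange-halves L h x∈R
  ... | inj₁ x∈l = ∈-++⁺ˡ (enter-complete h L _ T (leftChildren-represent h L ts T reps) x∈l Tx)
  ... | inj₂ x∈r = ∈-++⁺ʳ _ (enter-complete h (L + 2 ^ h) _ T (rightChildren-represent h L ts T reps) x∈r Tx)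

length-filter-disjoint : ∀ {a p} {A : Set a} {P Q R : A → Set p}
                         (P? : Decidable P) (Q? : Decidable Q) (R? : Decidable R)
                       → (∀ {x} → P x → Q x → ⊥) → (∀ {x} → P x → R x) → (∀ {x} → Q x → R x)
                       → ∀ xs → length (filter P? xs) + length (filter Q? xs) ≤ length (filter R? xs)
length-filter-disjoint P? Q? R? disjoint P⇒R Q⇒R [] = z≤n
length-filter-disjoint P? Q? R? disjoint P⇒R Q⇒R (x ∷ xs)
  with ih ← length-filter-disjoint P? Q? R? disjoint P⇒R Q⇒R xs | P? x | Q? x | R? x
... | yes Px | yes Qx | _      = ⊥-elim (disjoint Px Qx)
... | yes Px | no _   | no ¬Rx = ⊥-elim (¬Rx (P⇒R Px))
... | no _   | yes Qx | no ¬Rx = ⊥-elim (¬Rx (Q⇒R Qx))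
... | yes _  | no _   | yes _  = s≤s ih
... | no _   | yes _  | yes _  = ≤-trans (≤-reflexive (+-suc (length (filter P? xs)) _)) (s≤s ih)
... | no _   | no _   | yes _  = m≤n⇒m≤1+n ih
... | no _   | no _   | no _   = ih

boundaries : ℕ → ℕ → List ℕ → ℕ
boundaries L R B = length (filter (λ b → L <? b ×-dec b <? R) B)

boundaries-split : ∀ {L M R} → L ≤ M → M ≤ R
                 → ∀ B → boundaries L M B + boundaries M R B ≤ boundaries L R B
boundaries-split L≤M M≤R = length-filter-disjoint _ _ _
  (λ (_ , b<M) (M<b , _) → <-asym b<M M<b)
  (λ (L<b , b<M) → L<b , <-≤-trans b<M M≤R)
  (λ (M<b , b<R) → ≤-<-trans L≤M M<b , b<R)

boundaries-halves : ∀ L h B → boundaries L (L + 2 ^ h) B + boundaries (L + 2 ^ h) (L + 2 ^ h + 2 ^ h) B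
                              ≤ boundaries L (L + 2 ^ suc h) B
boundaries-halves L h rewrite m+2^n+2^n≡m+2^[1+n] L h =
  boundaries-split (m≤m+n L (2 ^ h)) (m+2^n≤m+2^[1+n] L h)

boundaries-pos : ∀ {L R B} → Any (λ b → L < b × b < R) B → 0 < boundaries L R B
boundaries-pos {L} {R} = filter-some (λ b → L <? b ×-dec b <? R)

boundaries≤length : ∀ L R B → boundaries L R B ≤ length B
boundaries≤length L R = length-filter (λ b → L <? b ×-dec b <? R)

Splits : ∀ {k} → List ℕ → (Fin k → ℕ → Set) → Set
Splits B T = ∀ L R → suc L < R → (∀ j → Meets L R (T j)) → Any (λ b → L < b × b < R) B

cost-leaf : ∀ k d n → k + k ≤ k * (2 * 2 ^ d + n)
cost-leaf k d n = begin
  k + k               ≡⟨ k+k≡k*2 k ⟩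
  k * 2               ≤⟨ *-monoʳ-≤ k (≤-trans (*-monoʳ-≤ 2 (m^n>0 2 d)) (m≤m+n (2 * 2 ^ d) n)) ⟩
  k * (2 * 2 ^ d + n) ∎
  where
  open ≤-Reasoning
  k+k≡k*2 : ∀ k → k + k ≡ k * 2
  k+k≡k*2 = solve-∀

cost-node : ∀ k a b x y → a + k ≤ k * x → b + k ≤ k * y → k + a + b + k ≤ k * (x + y)
cost-node k a b x y a+k≤kx b+k≤ky = begin
  k + a + b + k     ≡⟨ regroup k a b ⟩
  (a + k) + (b + k) ≤⟨ +-mono-≤ a+k≤kx b+k≤ky ⟩
  k * x + k * y     ≡⟨ sym (*-distribˡ-+ k x y) ⟩
  k * (x + y)       ∎
  where
  open ≤-Reasoning
  regroup : ∀ k a b → k + a + b + k ≡ (a + k) + (b + k)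
  regroup = solve-∀

budget-by-boundaries : ∀ h nl nr n → 0 < n → nl + nr ≤ n
                     → (2 + 2 * h * nl) + (2 + 2 * h * nr) ≤ 2 + 2 * suc h * n
budget-by-boundaries h nl nr n 0<n nl+nr≤n = begin
  (2 + 2 * h * nl) + (2 + 2 * h * nr) ≡⟨ collect h nl nr ⟩
  2 + 2 + 2 * h * (nl + nr)           ≤⟨ +-mono-≤ (+-monoʳ-≤ 2 (*-monoʳ-≤ 2 0<n)) (*-monoʳ-≤ (2 * h) nl+nr≤n) ⟩
  2 + 2 * n + 2 * h * n               ≡⟨ expand h n ⟩
  2 + 2 * suc h * n                   ∎
  where
  open ≤-Reasoning
  collect : ∀ h nl nr → (2 + 2 * h * nl) + (2 + 2 * h * nr) ≡ 2 + 2 + 2 * h * (nl + nr)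
  collect = solve-∀
  expand : ∀ h n → 2 + 2 * n + 2 * h * n ≡ 2 + 2 * suc h * n
  expand = solve-∀

budget-by-nodes : ∀ p s nl nr n → nl + nr ≤ n → (2 * p + s * nl) + (2 * p + s * nr) ≤ 2 * (2 * p) + s * n
budget-by-nodes p s nl nr n nl+nr≤n = begin
  (2 * p + s * nl) + (2 * p + s * nr) ≡⟨ collect p s nl nr ⟩
  2 * (2 * p) + s * (nl + nr)         ≤⟨ +-monoʳ-≤ (2 * (2 * p)) (*-monoʳ-≤ s nl+nr≤n) ⟩
  2 * (2 * p) + s * n                 ∎
  where
  open ≤-Reasoning
  collect : ∀ p s nl nr → (2 * p + s * nl) + (2 * p + s * nr) ≡ 2 * (2 * p) + s * (nl + nr)
  collect = solve-∀

module _ {k} (T : Fin k → ℕ → Set) (B : List ℕ) (splits : Splits B T) where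

  node-has-boundary : ∀ h L (ts : Vec (Trie (suc h)) k) → AllRepresent (suc h) L (just ts) T
                    → 0 < boundaries L (L + 2 ^ suc h) B
  node-has-boundary h L ts reps = boundaries-pos (splits L (L + 2 ^ suc h) 2+L≤R
    λ j → representsT-meets (suc h) L (lookup ts j) (reps j))
    where
    2+L≤R : 2 + L ≤ L + 2 ^ suc h
    2+L≤R = subst (_≤ L + 2 ^ suc h) (+-comm L 2) (+-monoʳ-≤ L (*-monoʳ-≤ 2 (m^n>0 2 h)))

  -- The top d levels are paid for by node count, the remaining h ∸ d levels by boundaries.
  mutual
    enter-cost : ∀ h d L mv → AllRepresent h L mv T
               → proj₂ (enter h L mv) + k ≤ k * (2 * 2 ^ d + 2 * (h ∸ d) * boundaries L (L + 2 ^ h) B)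
    enter-cost h d L nothing _ = cost-leaf k d _
    enter-cost h d L (just ts) = visit-cost h d L ts

    visit-cost : ∀ h d L (ts : Vec (Trie h) k) → AllRepresent h L (just ts) T
               → proj₂ (visit h L ts) + k ≤ k * (2 * 2 ^ d + 2 * (h ∸ d) * boundaries L (L + 2 ^ h) B)
    visit-cost zero d L ts _ = cost-leaf k d _
    visit-cost (suc h) zero L ts reps =
      ≤-trans (cost-node k _ _ _ _ (enter-cost h 0 L _ left) (enter-cost h 0 (L + 2 ^ h) _ right))
              (*-monoʳ-≤ k (budget-by-boundaries h _ _ _ (node-has-boundary h L ts reps) (boundaries-halves L h B)))
      where
      left : AllRepresent h L (allJust (map leftChild ts)) T
      left = leftChildren-represent h L ts T reps
      right : AllRepresent h (L + 2 ^ h) (allJust (map rightChild ts)) T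
      right = rightChildren-represent h L ts T reps
    visit-cost (suc h) (suc d) L ts reps =
      ≤-trans (cost-node k _ _ _ _ (enter-cost h d L _ left) (enter-cost h d (L + 2 ^ h) _ right))
              (*-monoʳ-≤ k (budget-by-nodes (2 ^ d) (2 * (h ∸ d)) _ _ _ (boundaries-halves L h B)))
      where
      left : AllRepresent h L (allJust (map leftChild ts)) T
      left = leftChildren-represent h L ts T reps
      right : AllRepresent h (L + 2 ^ h) (allJust (map rightChild ts)) T
      right = rightChildren-represent h L ts T reps

certificate-splits : ∀ {u k} (S : Fin (suc k) → List ℕ) → (∀ j x → x ∈ S j → x < u)
                   → ∀ {P} → IsPartitionCertificate u S P → Splits (List.map proj₂ P) (λ j x → x ∈ S j)
certificate-splits {u} S bound {P} (_ , singletons , separated) L R 2+L≤R meets =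
  split (all? λ j → L ∈? S j)
  where
  L<u : L < u
  L<u = let (y , (L≤y , _) , y∈S) = meets zero in ≤-<-trans L≤y (bound zero y y∈S)
  boundary : ∀ {lo hi} → (lo , hi) ∈ P → L < hi → hi < R → Any (λ b → L < b × b < R) (List.map proj₂ P)
  boundary lohi∈P L<hi hi<R = lose (∈-map⁺ proj₂ lohi∈P) (L<hi , hi<R)
  split : Dec (InAll S L) → Any (λ b → L < b × b < R) (List.map proj₂ P)
  split (yes L∈all) = boundary (singletons L L<u L∈all) ≤-refl 2+L≤R
  split (no L∉all) with separated L L<u L∉all
  ... | lo , hi , lohi∈P , lo≤L , L<hi , j , gap with hi <? R
  ...   | yes hi<R = boundary lohi∈P L<hi hi<R
  ...   | no hi≮R =
    let (y , (L≤y , y<R) , y∈Sj) = meets j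
    in ⊥-elim (gap y (≤-trans lo≤L L≤y) (<-≤-trans y<R (≮⇒≥ hi≮R)) y∈Sj)

2*⌊n/2⌋≤n : ∀ n → 2 * ⌊ n /2⌋ ≤ n
2*⌊n/2⌋≤n n = begin
  2 * ⌊ n /2⌋       ≡⟨ cong (⌊ n /2⌋ +_) (+-identityʳ ⌊ n /2⌋) ⟩
  ⌊ n /2⌋ + ⌊ n /2⌋ ≤⟨ +-monoʳ-≤ ⌊ n /2⌋ (⌊n/2⌋≤⌈n/2⌉ n) ⟩
  ⌊ n /2⌋ + ⌈ n /2⌉ ≡⟨ ⌊n/2⌋+⌈n/2⌉≡n n ⟩
  n                 ∎
  where open ≤-Reasoning

n≤2*⌈n/2⌉ : ∀ n → n ≤ 2 * ⌈ n /2⌉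
n≤2*⌈n/2⌉ n = begin
  n                 ≡⟨ ⌊n/2⌋+⌈n/2⌉≡n n ⟨
  ⌊ n /2⌋ + ⌈ n /2⌉ ≤⟨ +-monoˡ-≤ ⌈ n /2⌉ (⌊n/2⌋≤⌈n/2⌉ n) ⟩
  ⌈ n /2⌉ + ⌈ n /2⌉ ≡⟨ cong (⌈ n /2⌉ +_) (+-identityʳ ⌈ n /2⌉) ⟨
  2 * ⌈ n /2⌉       ∎
  where open ≤-Reasoning

2^⌊log₂n⌋≤n : ∀ n .{{_ : NonZero n}} → 2 ^ ⌊log₂ n ⌋ ≤ n
2^⌊log₂n⌋≤n n = go n (<-wellFounded n)
  where
  go : ∀ n .{{_ : NonZero n}} (rec : Acc _<_ n) → 2 ^ ⌊log2⌋ n rec ≤ n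
  go 1 _ = ≤-refl
  go (suc (suc n)) (acc rs) = begin
    2 * 2 ^ ⌊log2⌋ (suc ⌊ n /2⌋) _ ≤⟨ *-monoʳ-≤ 2 (go (suc ⌊ n /2⌋) _) ⟩
    2 * suc ⌊ n /2⌋                ≡⟨ *-suc 2 ⌊ n /2⌋ ⟩
    2 + 2 * ⌊ n /2⌋                ≤⟨ +-monoʳ-≤ 2 (2*⌊n/2⌋≤n n) ⟩
    2 + n                          ∎
    where open ≤-Reasoning

n≤2^⌈log₂n⌉ : ∀ n → n ≤ 2 ^ ⌈log₂ n ⌉
n≤2^⌈log₂n⌉ n = go n (<-wellFounded n)
  where
  go : ∀ n (rec : Acc _<_ n) → n ≤ 2 ^ ⌈log2⌉ n rec
  go 0 _ = z≤n
  go 1 _ = ≤-refl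
  go (suc (suc n)) (acc rs) = begin
    2 + n                          ≤⟨ +-monoʳ-≤ 2 (n≤2*⌈n/2⌉ n) ⟩
    2 + 2 * ⌈ n /2⌉                ≡⟨ *-suc 2 ⌈ n /2⌉ ⟨
    2 * suc ⌈ n /2⌉                ≤⟨ *-monoʳ-≤ 2 (go (suc ⌈ n /2⌉) _) ⟩
    2 * 2 ^ ⌈log2⌉ (suc ⌈ n /2⌉) _ ∎
    where open ≤-Reasoning

n<2^[1+⌊log₂n⌋] : ∀ n → n < 2 ^ suc ⌊log₂ n ⌋
n<2^[1+⌊log₂n⌋] n with n <? 2 ^ suc ⌊log₂ n ⌋
... | yes n<2^[1+g] = n<2^[1+g]
... | no n≮2^[1+g] = ⊥-elim (1+n≰n (begin
  suc ⌊log₂ n ⌋                  ≡⟨ ⌊log₂[2^n]⌋≡n (suc ⌊log₂ n ⌋) ⟨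
  ⌊log₂ 2 ^ suc ⌊log₂ n ⌋ ⌋      ≤⟨ ⌊log₂⌋-mono-≤ (≮⇒≥ n≮2^[1+g]) ⟩
  ⌊log₂ n ⌋                      ∎))
  where open ≤-Reasoning

n≤2^m⇒⌈log₂n⌉≤m : ∀ {n} m → n ≤ 2 ^ m → ⌈log₂ n ⌉ ≤ m
n≤2^m⇒⌈log₂n⌉≤m m n≤2^m = ≤-trans (⌈log₂⌉-mono-≤ n≤2^m) (≤-reflexive (⌈log₂2^n⌉≡n m))

n≤2^[⌊log₂d⌋+2+⌊log₂[n/d]⌋] : ∀ n d .{{_ : NonZero d}}
                            → n ≤ 2 ^ (⌊log₂ d ⌋ + (2 + ⌊log₂ (n / d) ⌋))
n≤2^[⌊log₂d⌋+2+⌊log₂[n/d]⌋] n d = begin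
  n                                 ≡⟨ m≡m%n+[m/n]*n n d ⟩
  n % d + n / d * d                 ≤⟨ +-monoˡ-≤ (n / d * d) (<⇒≤ (m%n<n n d)) ⟩
  suc (n / d) * d                   ≤⟨ *-mono-≤ (n<2^[1+⌊log₂n⌋] (n / d)) (<⇒≤ (n<2^[1+⌊log₂n⌋] d)) ⟩
  2 ^ suc r * 2 ^ suc g             ≡⟨ ^-distribˡ-+-* 2 (suc r) (suc g) ⟨
  2 ^ (suc r + suc g)               ≡⟨ cong (2 ^_) (exponents r g) ⟩
  2 ^ (g + (2 + r))                 ∎
  where
  open ≤-Reasoning
  r g : ℕ
  r = ⌊log₂ (n / d) ⌋
  g = ⌊log₂ d ⌋
  exponents : ∀ r g → suc r + suc g ≡ g + (2 + r)
  exponents = solve-∀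

cost≤6kδ[1+r] : ∀ c k δ r p s n → c + k ≤ k * (2 * p + 2 * s * n) → p ≤ δ → s ≤ 2 + r → n ≤ δ
           → c ≤ 6 * k * δ * (1 + r)
cost≤6kδ[1+r] c k δ r p s n c+k≤ p≤δ s≤2+r n≤δ = begin
  c                                 ≤⟨ m≤m+n c k ⟩
  c + k                             ≤⟨ c+k≤ ⟩
  k * (2 * p + 2 * s * n)           ≤⟨ *-monoʳ-≤ k (+-mono-≤ (*-monoʳ-≤ 2 p≤δ) (*-mono-≤ (*-monoʳ-≤ 2 s≤2+r) n≤δ)) ⟩
  k * (2 * δ + 2 * (2 + r) * δ)     ≤⟨ *-monoʳ-≤ k (m≤m+n _ (4 * r * δ)) ⟩
  k * (2 * δ + 2 * (2 + r) * δ + 4 * r * δ) ≡⟨ normalise k δ r ⟩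
  6 * k * δ * (1 + r)               ∎
  where
  open ≤-Reasoning
  normalise : ∀ k δ r → k * (2 * δ + 2 * (2 + r) * δ + 4 * r * δ) ≡ 6 * k * δ * (1 + r)
  normalise = solve-∀

module _ (u : ℕ) {k} (S : Fin (suc k) → List ℕ) (bound : ∀ j x → x ∈ S j → x < u) where

  private
    H : ℕ
    H = ⌈log₂ u ⌉
    roots : Vec (Maybe (Trie H)) (suc k)
    roots = tabulate (λ j → bintrie H (S j))

  below-2^H : ∀ j x → x ∈ S j → x < 2 ^ H
  below-2^H j x x∈S = <-≤-trans (bound j x x∈S) (n≤2^⌈log₂n⌉ u)

  roots-represent : AllRepresent H 0 (allJust roots) (λ j x → x ∈ S j)
  roots-represent = allJust-represent H 0 roots _ λ j →
    subst (λ t → Represents H 0 t (_∈ S j)) (sym (lookup∘tabulate (λ j → bintrie H (S j)) j))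
      (bintrie-represents H (S j) (below-2^H j))

  tpIntersection-correct : ∀ x → x ∈ proj₁ (tpIntersection H roots) ⇔ InAll S x
  tpIntersection-correct x = mk⇔ (proj₂ ∘ enter-sound H 0 _ _ roots-represent)
    λ x∈all → enter-complete H 0 _ _ roots-represent (z≤n , below-2^H zero x (x∈all zero)) x∈all

  tpIntersection-cost : 1 ≤ u → ∀ P → IsPartitionCertificate u S P
                      → proj₂ (tpIntersection H roots) ≤ 6 * suc k * length P * (1 + lgRatio u (length P))
  tpIntersection-cost 1≤u [] (0≡u , _) = ⊥-elim (<-irrefl 0≡u 1≤u)
  tpIntersection-cost 1≤u P@(_ ∷ P′) cert =
    cost≤6kδ[1+r] _ (suc k) δ r (2 ^ g) (H ∸ g) _
      (enter-cost (λ j x → x ∈ S j) B (certificate-splits S bound cert) H g 0 _ roots-represent)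
      (2^⌊log₂n⌋≤n δ)
      (m≤n+o⇒m∸n≤o H g (n≤2^m⇒⌈log₂n⌉≤m _ (n≤2^[⌊log₂d⌋+2+⌊log₂[n/d]⌋] u δ)))
      (≤-trans (boundaries≤length 0 (2 ^ H) B) (≤-reflexive (length-map proj₂ P)))
    where
    δ g r : ℕ
    δ = suc (length P′)
    g = ⌊log₂ δ ⌋
    r = ⌊log₂ (u / δ) ⌋
    B : List ℕ
    B = List.map proj₂ P

theorem3p2 : ∃[ c ] (∀ (u N k : ℕ) → 1 ≤ u → 1 ≤ k
    → (S : Fin N → List ℕ) → (∀ i x → x ∈ S i → x < u)
    → (Q : Fin k → Fin N) → Injective _≡_ _≡_ Q
    → (δ : ℕ) → IsAlternationMeasure u (λ j → S (Q j)) δ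
    → (∀ x → x ∈ proj₁ (tpIntersection ⌈log₂ u ⌉ (tabulate (λ j → bintrie ⌈log₂ u ⌉ (S (Q j))))) ⇔ InAll (λ j → S (Q j)) x)
      × proj₂ (tpIntersection ⌈log₂ u ⌉ (tabulate (λ j → bintrie ⌈log₂ u ⌉ (S (Q j))))) ≤ c * k * δ * (1 + lgRatio u δ))
theorem3p2 = 6 , λ where
  u N (suc k) 1≤u _ S bound Q _ δ ((P , cert , refl) , _) →
    tpIntersection-correct u (S ∘ Q) (bound ∘ Q) ,
    tpIntersection-cost u (S ∘ Q) (bound ∘ Q) 1≤u P cert
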